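{- For all integers $m\ge 2$ and all $n\in\mathbb{N}$, we have $g_m(n)\le 2n$ if and only if $(m,n)\notin\{(2,2),(2,3),(3,4)\}$.
   Context: $\mathbb{N}=\{0,1,2,\dots\}$. For an integer $m\ge 2$, an $m$-product sequence is a finite sequence of integers $a_1\le a_2\le\dots\le a_t$ such that $\prod_{i=1}^t a_i=R^m$ for some $R\in\mathbb{N}$ and no integer appears more than $m-1$ times in the sequence. For $n\in\mathbb{N}$, $g_m(n)$ is the least integer $s$ such that there exists an $m$-product sequence $a_1\le\dots\le a_t$ with $a_1=n$ and $a_t=s$. -}

module Defs where

open import Data.Nat using (ℕ; _∸_; _^_) renaming (_≤_ to _≤ℕ_)
open import Data.Integer using (ℤ; +_; _*_; _≤_; _≟_)
open import Data.List using (List; foldr; filter; length; head; last)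
open import Data.List.Relation.Unary.Linked using (Linked)
open import Data.Maybe using (just)
open import Data.Product using (Σ; _×_)
open import Relation.Binary.PropositionalEquality using (_≡_)

prodℤ : List ℤ → ℤ
prodℤ = foldr _*_ (+ 1)

count : ℤ → List ℤ → ℕ
count x as = length (filter (_≟ x) as)

record IsProductSeq (m : ℕ) (as : List ℤ) : Set where
  field
    sorted       : Linked _≤_ as
    isPower      : Σ ℕ (λ R → prodℤ as ≡ + (R ^ m))
    multiplicity : (x : ℤ) → count x as ≤ℕ (m ∸ 1)

Attains : ℕ → ℕ → ℤ → Set
Attains m n s = Σ (List ℤ) (λ as →
  IsProductSeq m as × (head as ≡ just (+ n)) × (last as ≡ just s))

IsG : ℕ → ℕ → ℤ → Set
IsG m n s = Attains m n s × ((s' : ℤ) → Attains m n s' → s ≤ s')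

module Submission where

-- Upper bound: with m = k + 2, the identities 8X·9X = 6X·12X, 8X·9X·2n = n·(12X)² and
-- n·8X·9X = (6X)²·2n make
--   (6X)^(k+1), 8X, 9X, (12X)^(k+1)    (n = 6X),
--   n^(k+1), 8X, 9X, (12X)^k, 2n        (6X < n < 8X),
--   n, (6X)^k, 8X, 9X, (2n)^(k+1)       (9X < 2n < 12X)
-- m-product sequences from n to 2n. For n ≥ 18 and X = ⌊n/6⌋ ≥ 3 either n = 6X or 6X < n < 8X;
-- the n ≤ 17 not covered with X ≤ 3 get explicit sequences.
-- Lower bound in the exceptional cases: a sequence from n ending at most at 2n has all its terms
-- in [n, 2n], so its product is ∏ v^(c v) over n ≤ v ≤ 2n with 1 ≤ c n and every c v ≤ m - 1;
-- a finite search over these exponents finds no m-th power.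

open import Defs

-- Everything except the theorem lives in this anonymous module, so that ℕ's _≤_ used
-- throughout does not clash with ℤ's _≤_, which the statement of the theorem needs unqualified.
module _ where
  open import Algebra.Properties.CommutativeSemigroup using (interchange; x∙yz≈y∙xz)
  open import Data.Bool using (Bool; true; false; T)
  open import Data.Bool.ListAction using (all)
  open import Data.Empty using (⊥; ⊥-elim)
  open import Data.Integer as ℤ using (ℤ; +_; +≤+)
  import Data.Integer.Properties as ℤₚ
  open import Data.List using (List; []; _∷_; _++_; [_]; replicate; concatMap; map; filter; length; head; last; applyUpTo; upTo)
  open import Data.List.Properties using (filter-++; length-++; length-filter; length-replicate; filter-none; filter-accept; filter-reject; concatMap-++; ++-identityʳ)
  open import Data.List.Membership.Propositional using (_∈_)
  open import Data.List.Membership.Propositional.Properties using (∈-applyUpTo⁺; ∈-upTo⁺)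
  open import Data.List.Relation.Unary.All as All using (All; []; _∷_)
  import Data.List.Relation.Unary.All.Properties as All
  open import Data.List.Relation.Unary.AllPairs using (AllPairs; []; _∷_)
  import Data.List.Relation.Unary.AllPairs as AllPairs
  import Data.List.Relation.Unary.AllPairs.Properties as AllPairs
  open import Data.List.Relation.Unary.Any using (here; there)
  open import Data.List.Relation.Unary.Linked using (Linked; [-]; _∷_)
  open import Data.List.Relation.Unary.Linked.Properties using (Linked⇒All; Linked⇒AllPairs; AllPairs⇒Linked)
  open import Data.List.Relation.Unary.Unique.Propositional using (Unique)
  import Data.List.Relation.Unary.Unique.Propositional.Properties as Unique
  open import Data.Maybe using (just)
  open import Data.Nat
  open import Data.Nat.DivMod using (_/_; _%_; m≡m%n+[m/n]*n; m%n<n; /-monoˡ-≤)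
  open import Data.Nat.ListAction using (product)
  open import Data.Nat.Properties
  open import Data.Nat.Tactic.RingSolver using (solve-∀)
  open import Data.Product using (∃-syntax; Σ-syntax; _×_; _,_; proj₁; proj₂)
  open import Data.Sum using (_⊎_; inj₁; inj₂)
  open import Function using (_∘_; _on_)
  open import Relation.Binary.PropositionalEquality using (_≡_; _≢_; refl; sym; trans; cong; cong₂; subst; module ≡-Reasoning)
  open import Relation.Nullary using (¬_; yes; no)

  ^-distrib-* : ∀ a b k → (a * b) ^ k ≡ a ^ k * b ^ k
  ^-distrib-* a b zero = refl
  ^-distrib-* a b (suc k) = begin
    a * b * (a * b) ^ k     ≡⟨ cong (a * b *_) (^-distrib-* a b k) ⟩
    a * b * (a ^ k * b ^ k) ≡⟨ interchange *-commutativeSemigroup a b (a ^ k) (b ^ k) ⟩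
    a * a ^ k * (b * b ^ k) ∎
    where open ≡-Reasoning

  Block : Set
  Block = ℕ × ℕ

  block : Block → List ℤ
  block (v , k) = replicate k (+ v)

  expand : List Block → List ℤ
  expand = concatMap block

  blockProduct : List Block → ℕ
  blockProduct [] = 1
  blockProduct ((v , k) ∷ bs) = v ^ k * blockProduct bs

  prodℤ-++ : ∀ xs ys → prodℤ (xs ++ ys) ≡ prodℤ xs ℤ.* prodℤ ys
  prodℤ-++ [] ys = sym (ℤₚ.*-identityˡ (prodℤ ys))
  prodℤ-++ (x ∷ xs) ys = trans (cong (x ℤ.*_) (prodℤ-++ xs ys)) (sym (ℤₚ.*-assoc x (prodℤ xs) (prodℤ ys)))

  prodℤ-replicate : ∀ k v → prodℤ (replicate k (+ v)) ≡ + (v ^ k)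
  prodℤ-replicate zero v = refl
  prodℤ-replicate (suc k) v = trans (cong (+ v ℤ.*_) (prodℤ-replicate k v)) (sym (ℤₚ.pos-* v (v ^ k)))

  prodℤ-expand : ∀ bs → prodℤ (expand bs) ≡ + blockProduct bs
  prodℤ-expand [] = refl
  prodℤ-expand ((v , k) ∷ bs) = begin
    prodℤ (block (v , k) ++ expand bs)                ≡⟨ prodℤ-++ (block (v , k)) (expand bs) ⟩
    prodℤ (replicate k (+ v)) ℤ.* prodℤ (expand bs) ≡⟨ cong₂ ℤ._*_ (prodℤ-replicate k v) (prodℤ-expand bs) ⟩
    + (v ^ k) ℤ.* + blockProduct bs                   ≡⟨ ℤₚ.pos-* (v ^ k) (blockProduct bs) ⟨
    + (v ^ k * blockProduct bs)                       ∎
    where open ≡-Reasoning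

  expand⁺ : ∀ {P : ℤ → Set} {bs} → All (P ∘ +_ ∘ proj₁) bs → All P (expand bs)
  expand⁺ ps = All.concat⁺ (All.map⁺ (All.map (All.replicate⁺ _) ps))

  replicate-sorted : ∀ k x → AllPairs ℤ._≤_ (replicate k x)
  replicate-sorted zero x = []
  replicate-sorted (suc k) x = All.replicate⁺ k ℤₚ.≤-refl ∷ replicate-sorted k x

  expand-sorted : ∀ {bs} → Linked (_<_ on proj₁) bs → Linked ℤ._≤_ (expand bs)
  expand-sorted inc = AllPairs⇒Linked (AllPairs.concat⁺
    (All.map⁺ (All.universal (λ b → replicate-sorted (proj₂ b) (+ proj₁ b)) _))
    (AllPairs.map⁺ (AllPairs.map blocks-ordered (Linked⇒AllPairs <-trans inc))))
    where
    blocks-ordered : ∀ {b c} → proj₁ b < proj₁ c → All (λ x → All (x ℤ.≤_) (block c)) (block b)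
    blocks-ordered b<c = All.replicate⁺ _ (All.replicate⁺ _ (+≤+ (<⇒≤ b<c)))

  count-++ : ∀ x xs ys → count x (xs ++ ys) ≡ count x xs + count x ys
  count-++ x xs ys = trans (cong length (filter-++ (ℤ._≟ x) xs ys)) (length-++ (filter (ℤ._≟ x) xs))

  count-≡0 : ∀ {x xs} → All (_≢ x) xs → count x xs ≡ 0
  count-≡0 {x} xs≢x = cong length (filter-none (ℤ._≟ x) xs≢x)

  count-block-≤ : ∀ x b → count x (block b) ≤ proj₂ b
  count-block-≤ x (v , k) = ≤-trans (length-filter (ℤ._≟ x) (replicate k (+ v))) (≤-reflexive (length-replicate k))

  count-expand-≤ : ∀ {M bs} → AllPairs (_<_ on proj₁) bs → All ((_≤ M) ∘ proj₂) bs → ∀ x → count x (expand bs) ≤ M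
  count-expand-≤ [] [] x = z≤n
  count-expand-≤ {M} {(v , k) ∷ bs} (v<bs ∷ inc) (k≤M ∷ ks≤M) x with + v ℤ.≟ x
  ... | yes refl = begin
    count (+ v) (block (v , k) ++ expand bs)              ≡⟨ count-++ (+ v) (block (v , k)) (expand bs) ⟩
    count (+ v) (block (v , k)) + count (+ v) (expand bs) ≡⟨ cong₂ _+_ refl (count-≡0 later≢v) ⟩
    count (+ v) (block (v , k)) + 0                       ≡⟨ +-identityʳ _ ⟩
    count (+ v) (block (v , k))                           ≤⟨ count-block-≤ (+ v) (v , k) ⟩
    k                                                     ≤⟨ k≤M ⟩
    M                                                     ∎
    where
    open ≤-Reasoning
    later≢v : All (_≢ + v) (expand bs)
    later≢v = expand⁺ (All.map (λ v<w → <⇒≢ v<w ∘ sym ∘ ℤₚ.+-injective) v<bs)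
  ... | no v≢x = begin
    count x (block (v , k) ++ expand bs)          ≡⟨ count-++ x (block (v , k)) (expand bs) ⟩
    count x (block (v , k)) + count x (expand bs) ≡⟨ cong (_+ _) (count-≡0 (All.replicate⁺ k v≢x)) ⟩
    count x (expand bs)                           ≤⟨ count-expand-≤ inc ks≤M x ⟩
    M                                             ∎
    where open ≤-Reasoning

  last-++-∷ : ∀ {A : Set} (xs : List A) y ys → last (xs ++ y ∷ ys) ≡ last (y ∷ ys)
  last-++-∷ [] y ys = refl
  last-++-∷ (x ∷ []) y ys = refl
  last-++-∷ (x ∷ x′ ∷ xs) y ys = last-++-∷ (x′ ∷ xs) y ys

  last-replicate : ∀ {A : Set} j (y : A) → last (replicate (suc j) y) ≡ just y
  last-replicate zero y = refl
  last-replicate (suc j) y = last-replicate j y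

  expand-last : ∀ bs w j → last (expand (bs ++ [ w , suc j ])) ≡ just (+ w)
  expand-last bs w j = begin
    last (expand (bs ++ [ w , suc j ]))                 ≡⟨ cong last (concatMap-++ block bs [ w , suc j ]) ⟩
    last (expand bs ++ + w ∷ replicate j (+ w) ++ [])  ≡⟨ last-++-∷ (expand bs) (+ w) _ ⟩
    last (replicate (suc j) (+ w) ++ [])               ≡⟨ cong last (++-identityʳ (replicate (suc j) (+ w))) ⟩
    last (replicate (suc j) (+ w))                     ≡⟨ last-replicate j (+ w) ⟩
    just (+ w)                                         ∎
    where open ≡-Reasoning

  attains-of-blocks : ∀ {m n R} bs w j →
    Linked (_<_ on proj₁) (bs ++ [ w , suc j ]) →
    All ((_≤ m ∸ 1) ∘ proj₂) (bs ++ [ w , suc j ]) →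
    blockProduct (bs ++ [ w , suc j ]) ≡ R ^ m →
    head (expand (bs ++ [ w , suc j ])) ≡ just (+ n) →
    Attains m n (+ w)
  attains-of-blocks {R = R} bs w j inc mult prod first =
    expand (bs ++ [ w , suc j ]) ,
    record
      { sorted = expand-sorted inc
      ; isPower = R , trans (prodℤ-expand (bs ++ [ w , suc j ])) (cong +_ prod)
      ; multiplicity = count-expand-≤ (Linked⇒AllPairs <-trans inc) mult
      } ,
    first , expand-last bs w j

  attains-power : ∀ k {n} R → R ^ (2 + k) ≡ n → Attains (2 + k) n (+ n)
  attains-power k {n} R Rᵐ≡n = attains-of-blocks {R = R} [] n 0 [-] (s≤s z≤n ∷ [])
    (trans (trans (*-identityʳ (n * 1)) (*-identityʳ n)) (sym Rᵐ≡n)) refl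

  attains-n-vᵏ-w : ∀ k {n v w} → n < v → v < w → n * w ≡ v * v → Attains (2 + k) n (+ w)
  attains-n-vᵏ-w k {n} {v} {w} n<v v<w nw≡v² =
    attains-of-blocks {R = v} ((n , 1) ∷ (v , k) ∷ []) w 0
      (n<v ∷ v<w ∷ [-]) (s≤s z≤n ∷ n≤1+n k ∷ s≤s z≤n ∷ []) blocks≡Rᵐ refl
    where
    open ≡-Reasoning
    rearrange : ∀ n w V → n * 1 * (V * (w * 1 * 1)) ≡ n * w * V
    rearrange = solve-∀
    blocks≡Rᵐ : n * 1 * (v ^ k * (w * 1 * 1)) ≡ v ^ (2 + k)
    blocks≡Rᵐ = begin
      n * 1 * (v ^ k * (w * 1 * 1)) ≡⟨ rearrange n w (v ^ k) ⟩
      n * w * v ^ k                 ≡⟨ cong (_* v ^ k) nw≡v² ⟩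
      v * v * v ^ k                 ≡⟨ *-assoc v v (v ^ k) ⟩
      v ^ (2 + k)                   ∎

  attains-nᵏ⁺¹-x-y-wᵏ⁺¹ : ∀ k {n x y w} → n < x → x < y → y < w → x * y ≡ n * w → Attains (2 + k) n (+ w)
  attains-nᵏ⁺¹-x-y-wᵏ⁺¹ k {n} {x} {y} {w} n<x x<y y<w xy≡nw =
    attains-of-blocks {R = n * w} ((n , suc k) ∷ (x , 1) ∷ (y , 1) ∷ []) w k
      (n<x ∷ x<y ∷ y<w ∷ [-]) (≤-refl ∷ s≤s z≤n ∷ s≤s z≤n ∷ ≤-refl ∷ []) blocks≡Rᵐ refl
    where
    open ≡-Reasoning
    rearrange : ∀ n x y w N W → n * N * (x * 1 * (y * 1 * (w * W * 1))) ≡ x * y * (n * w) * (N * W)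
    rearrange = solve-∀
    blocks≡Rᵐ : n ^ suc k * (x * 1 * (y * 1 * (w ^ suc k * 1))) ≡ (n * w) ^ (2 + k)
    blocks≡Rᵐ = begin
      n ^ suc k * (x * 1 * (y * 1 * (w ^ suc k * 1))) ≡⟨ rearrange n x y w (n ^ k) (w ^ k) ⟩
      x * y * (n * w) * (n ^ k * w ^ k)               ≡⟨ cong₂ (λ a b → a * (n * w) * b) xy≡nw (sym (^-distrib-* n w k)) ⟩
      n * w * (n * w) * (n * w) ^ k                   ≡⟨ *-assoc (n * w) (n * w) _ ⟩
      (n * w) ^ (2 + k)                               ∎

  attains-n-vᵏ-x-y-wᵏ⁺¹ : ∀ k {n v x y w} → n < v → v < x → x < y → y < w → n * x * y ≡ v * v * w →
    Attains (2 + k) n (+ w)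
  attains-n-vᵏ-x-y-wᵏ⁺¹ k {n} {v} {x} {y} {w} n<v v<x x<y y<w nxy≡v²w =
    attains-of-blocks {R = v * w} ((n , 1) ∷ (v , k) ∷ (x , 1) ∷ (y , 1) ∷ []) w k
      (n<v ∷ v<x ∷ x<y ∷ y<w ∷ [-]) (s≤s z≤n ∷ n≤1+n k ∷ s≤s z≤n ∷ s≤s z≤n ∷ ≤-refl ∷ []) blocks≡Rᵐ refl
    where
    open ≡-Reasoning
    rearrange : ∀ n x y w V W → n * 1 * (V * (x * 1 * (y * 1 * (w * W * 1)))) ≡ n * x * y * w * (V * W)
    rearrange = solve-∀
    regroup : ∀ v w P → v * v * w * w * P ≡ v * w * (v * w * P)
    regroup = solve-∀
    blocks≡Rᵐ : n * 1 * (v ^ k * (x * 1 * (y * 1 * (w ^ suc k * 1)))) ≡ (v * w) ^ (2 + k)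
    blocks≡Rᵐ = begin
      n * 1 * (v ^ k * (x * 1 * (y * 1 * (w ^ suc k * 1)))) ≡⟨ rearrange n x y w (v ^ k) (w ^ k) ⟩
      n * x * y * w * (v ^ k * w ^ k)                       ≡⟨ cong₂ (λ a b → a * w * b) nxy≡v²w (sym (^-distrib-* v w k)) ⟩
      v * v * w * w * (v * w) ^ k                           ≡⟨ regroup v w _ ⟩
      (v * w) ^ (2 + k)                                     ∎

  attains-nᵏ⁺¹-x-y-vᵏ-w : ∀ k {n x y v w} → n < x → x < y → y < v → v < w → x * y * w ≡ n * v * v →
    Attains (2 + k) n (+ w)
  attains-nᵏ⁺¹-x-y-vᵏ-w k {n} {x} {y} {v} {w} n<x x<y y<v v<w xyw≡nv² =
    attains-of-blocks {R = n * v} ((n , suc k) ∷ (x , 1) ∷ (y , 1) ∷ (v , k) ∷ []) w 0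
      (n<x ∷ x<y ∷ y<v ∷ v<w ∷ [-]) (≤-refl ∷ s≤s z≤n ∷ s≤s z≤n ∷ n≤1+n k ∷ s≤s z≤n ∷ []) blocks≡Rᵐ refl
    where
    open ≡-Reasoning
    rearrange : ∀ n x y v w N V → n * N * (x * 1 * (y * 1 * (V * (w * 1 * 1)))) ≡ x * y * w * n * (N * V)
    rearrange = solve-∀
    regroup : ∀ n v P → n * v * v * n * P ≡ n * v * (n * v * P)
    regroup = solve-∀
    blocks≡Rᵐ : n ^ suc k * (x * 1 * (y * 1 * (v ^ k * (w * 1 * 1)))) ≡ (n * v) ^ (2 + k)
    blocks≡Rᵐ = begin
      n ^ suc k * (x * 1 * (y * 1 * (v ^ k * (w * 1 * 1)))) ≡⟨ rearrange n x y v w (n ^ k) (v ^ k) ⟩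
      x * y * w * n * (n ^ k * v ^ k)                       ≡⟨ cong₂ (λ a b → a * n * b) xyw≡nv² (sym (^-distrib-* n v k)) ⟩
      n * v * v * n * (n * v) ^ k                           ≡⟨ regroup n v _ ⟩
      (n * v) ^ (2 + k)                                     ∎

  attains-2ᵏ⁺¹-4 : ∀ k → Attains (3 + k) 2 (+ 4)
  attains-2ᵏ⁺¹-4 k = attains-of-blocks {R = 2} [ 2 , suc k ] 4 0
    (<ᵇ⇒< 2 4 _ ∷ [-]) (n≤1+n (suc k) ∷ s≤s z≤n ∷ []) (identity (2 ^ k)) refl
    where
    identity : ∀ P → 2 * P * (4 * 1 * 1) ≡ 2 * (2 * (2 * P))
    identity = solve-∀

  attains-3²-4-6ᵏ⁺¹ : ∀ k → Attains (3 + k) 3 (+ 6)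
  attains-3²-4-6ᵏ⁺¹ k = attains-of-blocks {R = 6} ((3 , 2) ∷ (4 , 1) ∷ []) 6 k
    (<ᵇ⇒< 3 4 _ ∷ <ᵇ⇒< 4 6 _ ∷ [-]) (s≤s (s≤s z≤n) ∷ s≤s z≤n ∷ n≤1+n (suc k) ∷ []) (identity (6 ^ k)) refl
    where
    identity : ∀ P → 3 * (3 * 1) * (4 * 1 * (6 * P * 1)) ≡ 6 * (6 * (6 * P))
    identity = solve-∀

  attains-4ᵏ⁺¹-8² : ∀ k → Attains (4 + k) 4 (+ 8)
  attains-4ᵏ⁺¹-8² k = attains-of-blocks {R = 4} [ 4 , suc k ] 8 1
    (<ᵇ⇒< 4 8 _ ∷ [-]) (m≤n+m (suc k) 2 ∷ s≤s (s≤s z≤n) ∷ []) (identity (4 ^ k)) refl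
    where
    identity : ∀ P → 4 * P * (8 * (8 * 1) * 1) ≡ 4 * (4 * (4 * (4 * P)))
    identity = solve-∀

  Doubles : ℕ → ℕ → Set
  Doubles m n = Attains m n (+ (2 * n))

  doubles-6X : ∀ k X .{{_ : NonZero X}} → Doubles (2 + k) (6 * X)
  doubles-6X k X = attains-nᵏ⁺¹-x-y-wᵏ⁺¹ k
    (*-monoˡ-< X (<ᵇ⇒< 6 8 _)) (*-monoˡ-< X (<ᵇ⇒< 8 9 _))
    (subst (9 * X <_) (*-assoc 2 6 X) (*-monoˡ-< X (<ᵇ⇒< 9 12 _))) (identity X)
    where
    identity : ∀ X → 8 * X * (9 * X) ≡ 6 * X * (2 * (6 * X))
    identity = solve-∀

  doubles-6X<n<8X : ∀ k X n .{{_ : NonZero X}} → 6 * X < n → n < 8 * X → Doubles (2 + k) n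
  doubles-6X<n<8X k X n 6X<n n<8X = attains-nᵏ⁺¹-x-y-vᵏ-w k n<8X
    (*-monoˡ-< X (<ᵇ⇒< 8 9 _)) (*-monoˡ-< X (<ᵇ⇒< 9 12 _))
    (subst (_< 2 * n) (sym (*-assoc 2 6 X)) (*-monoʳ-< 2 6X<n)) (identity X n)
    where
    identity : ∀ X n → 8 * X * (9 * X) * (2 * n) ≡ n * (12 * X) * (12 * X)
    identity = solve-∀

  doubles-9X<2n<12X : ∀ k X n .{{_ : NonZero X}} → 9 * X < 2 * n → 2 * n < 12 * X → Doubles (2 + k) n
  doubles-9X<2n<12X k X n 9X<2n 2n<12X = attains-n-vᵏ-x-y-wᵏ⁺¹ k
    (*-cancelˡ-< 2 n (6 * X) (subst (2 * n <_) (*-assoc 2 6 X) 2n<12X))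
    (*-monoˡ-< X (<ᵇ⇒< 6 8 _)) (*-monoˡ-< X (<ᵇ⇒< 8 9 _)) 9X<2n (identity X n)
    where
    identity : ∀ X n → n * (8 * X) * (9 * X) ≡ 6 * X * (6 * X) * (2 * n)
    identity = solve-∀

  doubles-from-18 : ∀ k n → 18 ≤ n → Doubles (2 + k) n
  doubles-from-18 k n 18≤n = subst (Doubles (2 + k)) (sym n≡6X+r) (by-remainder (n % 6) (m%n<n n 6))
    where
    X : ℕ
    X = n / 6
    3≤X : 3 ≤ X
    3≤X = /-monoˡ-≤ 6 18≤n
    instance
      X-nonZero : NonZero X
      X-nonZero = >-nonZero (<-≤-trans (s≤s z≤n) 3≤X)
    n≡6X+r : n ≡ 6 * X + n % 6
    n≡6X+r = trans (m≡m%n+[m/n]*n n 6) (trans (+-comm (n % 6) (X * 6)) (cong (_+ n % 6) (*-comm X 6)))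
    by-remainder : ∀ r → r < 6 → Doubles (2 + k) (6 * X + r)
    by-remainder zero _ = subst (Doubles (2 + k)) (sym (+-identityʳ (6 * X))) (doubles-6X k X)
    by-remainder r@(suc _) r<6 = doubles-6X<n<8X k X (6 * X + r) (m<m+n (6 * X) z<s) (begin-strict
      6 * X + r      <⟨ +-monoʳ-< (6 * X) (<-≤-trans r<6 (*-monoʳ-≤ 2 3≤X)) ⟩
      6 * X + 2 * X  ≡⟨ *-distribʳ-+ X 6 2 ⟨
      8 * X          ∎)
      where open ≤-Reasoning

  Exceptional : ℕ → ℕ → Set
  Exceptional m n = (m ≡ 2 × n ≡ 2) ⊎ (m ≡ 2 × n ≡ 3) ⊎ (m ≡ 3 × n ≡ 4)

  AttainsAtMost : ℕ → ℕ → ℕ → Set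
  AttainsAtMost m n b = Σ[ w ∈ ℕ ] w ≤ b × Attains m n (+ w)

  doubling : ∀ {m n} → Doubles m n → AttainsAtMost m n (2 * n)
  doubling d = _ , ≤-refl , d

  attains-at-most-double : ∀ k n → ¬ Exceptional (2 + k) n → AttainsAtMost (2 + k) n (2 * n)
  attains-at-most-double k 0 _ = 0 , z≤n , attains-power k 0 refl
  attains-at-most-double k 1 _ = 1 , s≤s z≤n , attains-power k 1 (^-zeroˡ (2 + k))
  attains-at-most-double 0 2 ¬exc = ⊥-elim (¬exc (inj₁ (refl , refl)))
  attains-at-most-double (suc k) 2 _ = 4 , ≤-refl , attains-2ᵏ⁺¹-4 k
  attains-at-most-double 0 3 ¬exc = ⊥-elim (¬exc (inj₂ (inj₁ (refl , refl))))
  attains-at-most-double (suc k) 3 _ = 6 , ≤-refl , attains-3²-4-6ᵏ⁺¹ k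
  attains-at-most-double 0 4 _ = 4 , ≤ᵇ⇒≤ 4 8 _ , attains-power 0 2 refl
  attains-at-most-double 1 4 ¬exc = ⊥-elim (¬exc (inj₂ (inj₂ (refl , refl))))
  attains-at-most-double (suc (suc k)) 4 _ = 8 , ≤-refl , attains-4ᵏ⁺¹-8² k
  attains-at-most-double k 5 _ = doubling (doubles-9X<2n<12X k 1 5 (<ᵇ⇒< 9 10 _) (<ᵇ⇒< 10 12 _))
  attains-at-most-double k 6 _ = doubling (doubles-6X k 1)
  attains-at-most-double k 7 _ = doubling (doubles-6X<n<8X k 1 7 (<ᵇ⇒< 6 7 _) (<ᵇ⇒< 7 8 _))
  attains-at-most-double k 8 _ =
    15 , ≤ᵇ⇒≤ 15 16 _ , attains-nᵏ⁺¹-x-y-wᵏ⁺¹ k (<ᵇ⇒< 8 10 _) (<ᵇ⇒< 10 12 _) (<ᵇ⇒< 12 15 _) refl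
  attains-at-most-double k 9 _ =
    16 , ≤ᵇ⇒≤ 16 18 _ , attains-n-vᵏ-w k (<ᵇ⇒< 9 12 _) (<ᵇ⇒< 12 16 _) refl
  attains-at-most-double k 10 _ = doubling (doubles-9X<2n<12X k 2 10 (<ᵇ⇒< 18 20 _) (<ᵇ⇒< 20 24 _))
  attains-at-most-double k 11 _ = doubling (doubles-9X<2n<12X k 2 11 (<ᵇ⇒< 18 22 _) (<ᵇ⇒< 22 24 _))
  attains-at-most-double k 12 _ = doubling (doubles-6X k 2)
  attains-at-most-double k 13 _ = doubling (doubles-6X<n<8X k 2 13 (<ᵇ⇒< 12 13 _) (<ᵇ⇒< 13 16 _))
  attains-at-most-double k 14 _ = doubling (doubles-6X<n<8X k 2 14 (<ᵇ⇒< 12 14 _) (<ᵇ⇒< 14 16 _))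
  attains-at-most-double k 15 _ = doubling (doubles-6X<n<8X k 2 15 (<ᵇ⇒< 12 15 _) (<ᵇ⇒< 15 16 _))
  attains-at-most-double k 16 _ = doubling (doubles-9X<2n<12X k 3 16 (<ᵇ⇒< 27 32 _) (<ᵇ⇒< 32 36 _))
  attains-at-most-double k 17 _ = doubling (doubles-9X<2n<12X k 3 17 (<ᵇ⇒< 27 34 _) (<ᵇ⇒< 34 36 _))
  attains-at-most-double k n@(suc (suc (suc (suc (suc (suc (suc (suc (suc (suc (suc (suc (suc (suc (suc (suc (suc (suc _)))))))))))))))))) _ =
    doubling (doubles-from-18 k n (m≤m+n 18 _))

  noRootFrom : (m P fuel R : ℕ) → Bool
  noRootFrom m P zero R = false
  noRootFrom m P (suc fuel) R with P <? R ^ m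
  ... | yes _ = true
  ... | no _ with P ≟ R ^ m
  ...   | yes _ = false
  ...   | no _ = noRootFrom m P fuel (suc R)

  noRootFrom-sound : ∀ m P fuel R → T (noRootFrom m P fuel R) → ∀ {R′} → R ≤ R′ → R′ ^ m ≢ P
  noRootFrom-sound m P (suc fuel) R ok R≤R′ R′ᵐ≡P with P <? R ^ m
  ... | yes P<Rᵐ = <⇒≱ P<Rᵐ (subst (R ^ m ≤_) R′ᵐ≡P (^-monoˡ-≤ m R≤R′))
  ... | no _ with P ≟ R ^ m
  ...   | yes _ = ok
  ...   | no P≢Rᵐ with m≤n⇒m<n∨m≡n R≤R′
  ...     | inj₁ R<R′ = noRootFrom-sound m P fuel (suc R) ok R<R′ R′ᵐ≡P
  ...     | inj₂ refl = P≢Rᵐ (sym R′ᵐ≡P)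

  powerProduct : List ℕ → (ℕ → ℕ) → ℕ
  powerProduct vs e = product (map (λ v → v ^ e v) vs)

  noPowerProducts : (m b acc : ℕ) → List ℕ → Bool
  noPowerProducts m b acc [] = noRootFrom m acc (suc acc) 0
  noPowerProducts m b acc (v ∷ vs) = all (λ e → noPowerProducts m b (acc * v ^ e) vs) (upTo (suc b))

  noPowerProducts-sound : ∀ {m b} acc vs e → All (λ v → e v ≤ b) vs → T (noPowerProducts m b acc vs) →
    ∀ R → R ^ m ≢ acc * powerProduct vs e
  noPowerProducts-sound {m} acc [] e [] ok R Rᵐ≡acc =
    noRootFrom-sound m acc (suc acc) 0 ok z≤n (trans Rᵐ≡acc (*-identityʳ acc))
  noPowerProducts-sound {m} {b} acc (v ∷ vs) e (ev≤b ∷ bounds) ok R Rᵐ≡acc·p =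
    noPowerProducts-sound (acc * v ^ e v) vs e bounds ok-e R (trans Rᵐ≡acc·p (sym (*-assoc acc (v ^ e v) _)))
    where
    ok-e : T (noPowerProducts m b (acc * v ^ e v) vs)
    ok-e = All.lookup (All.all⁺ _ (upTo (suc b)) ok) (∈-upTo⁺ (s≤s ev≤b))

  count-∷-≡ : ∀ x as → count x (x ∷ as) ≡ suc (count x as)
  count-∷-≡ x as = cong length (filter-accept (ℤ._≟ x) refl)

  count-∷-≢ : ∀ {x y} as → y ≢ x → count x (y ∷ as) ≡ count x as
  count-∷-≢ {x} as y≢x = cong length (filter-reject (ℤ._≟ x) y≢x)

  powerProduct-cong : ∀ {vs e e′} → All (λ v → e v ≡ e′ v) vs → powerProduct vs e ≡ powerProduct vs e′
  powerProduct-cong [] = refl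
  powerProduct-cong {v ∷ _} (e≡e′ ∷ es≡es′) = cong₂ _*_ (cong (v ^_) e≡e′) (powerProduct-cong es≡es′)

  powerProduct-zero : ∀ vs → powerProduct vs (λ _ → 0) ≡ 1
  powerProduct-zero [] = refl
  powerProduct-zero (v ∷ vs) = trans (*-identityˡ _) (powerProduct-zero vs)

  powerProduct-count-∷ : ∀ {w vs} as → Unique vs → w ∈ vs →
    powerProduct vs (λ v → count (+ v) (+ w ∷ as)) ≡ w * powerProduct vs (λ v → count (+ v) as)
  powerProduct-count-∷ {w} {_ ∷ vs} as (w∉vs ∷ _) (here refl) = begin
    w ^ count (+ w) (+ w ∷ as) * powerProduct vs (λ v → count (+ v) (+ w ∷ as))
      ≡⟨ cong₂ _*_ (cong (w ^_) (count-∷-≡ (+ w) as))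
                   (powerProduct-cong (All.map (λ w≢v → count-∷-≢ as (w≢v ∘ ℤₚ.+-injective)) w∉vs)) ⟩
    w * w ^ count (+ w) as * powerProduct vs (λ v → count (+ v) as)
      ≡⟨ *-assoc w _ _ ⟩
    w * (w ^ count (+ w) as * powerProduct vs (λ v → count (+ v) as)) ∎
    where open ≡-Reasoning
  powerProduct-count-∷ {w} {u ∷ vs} as (u∉vs ∷ unique) (there w∈vs) = begin
    u ^ count (+ u) (+ w ∷ as) * powerProduct vs (λ v → count (+ v) (+ w ∷ as))
      ≡⟨ cong₂ _*_ (cong (u ^_) (count-∷-≢ as (All.lookup u∉vs w∈vs ∘ sym ∘ ℤₚ.+-injective)))
                   (powerProduct-count-∷ as unique w∈vs) ⟩
    u ^ count (+ u) as * (w * powerProduct vs (λ v → count (+ v) as))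
      ≡⟨ x∙yz≈y∙xz *-commutativeSemigroup (u ^ count (+ u) as) w _ ⟩
    w * (u ^ count (+ u) as * powerProduct vs (λ v → count (+ v) as)) ∎
    where open ≡-Reasoning

  prodℤ-as-powerProduct : ∀ {vs} as → Unique vs → All (λ x → ∃[ v ] v ∈ vs × x ≡ + v) as →
    prodℤ as ≡ + powerProduct vs (λ v → count (+ v) as)
  prodℤ-as-powerProduct {vs} [] _ [] = cong +_ (sym (powerProduct-zero vs))
  prodℤ-as-powerProduct {vs} (_ ∷ as) unique ((w , w∈vs , refl) ∷ entries) = begin
    + w ℤ.* prodℤ as                                        ≡⟨ cong (+ w ℤ.*_) (prodℤ-as-powerProduct as unique entries) ⟩
    + w ℤ.* + powerProduct vs (λ v → count (+ v) as)        ≡⟨ ℤₚ.pos-* w _ ⟨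
    + (w * powerProduct vs (λ v → count (+ v) as))          ≡⟨ cong +_ (powerProduct-count-∷ as unique w∈vs) ⟨
    + powerProduct vs (λ v → count (+ v) (+ w ∷ as))        ∎
    where open ≡-Reasoning

  Linked-≤-head : ∀ {xs y} → Linked ℤ._≤_ xs → head xs ≡ just y → All (y ℤ.≤_) xs
  Linked-≤-head {x ∷ _} sorted refl = Linked⇒All ℤₚ.≤-trans ℤₚ.≤-refl sorted

  Linked-≤-last : ∀ {xs y} → Linked ℤ._≤_ xs → last xs ≡ just y → All (ℤ._≤ y) xs
  Linked-≤-last [-] refl = ℤₚ.≤-refl ∷ []
  Linked-≤-last (x≤x′ ∷ sorted) final with Linked-≤-last sorted final
  ... | x′≤y ∷ rest = ℤₚ.≤-trans x≤x′ x′≤y ∷ x′≤y ∷ rest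

  range-unique : ∀ n l → Unique (applyUpTo (_+ n) l)
  range-unique n l = Unique.applyUpTo⁺₁ (_+ n) l (λ {i} {j} i<j _ → <⇒≢ i<j ∘ +-cancelʳ-≡ n i j)

  ∈-range : ∀ {n hi x} → + n ℤ.≤ x → x ℤ.≤ + hi → ∃[ v ] v ∈ applyUpTo (_+ n) (suc (hi ∸ n)) × x ≡ + v
  ∈-range {n} {x = + v} (+≤+ n≤v) (+≤+ v≤hi) =
    v , subst (_∈ _) (m∸n+n≡m n≤v) (∈-applyUpTo⁺ (_+ n) (s≤s (∸-monoˡ-≤ n v≤hi))) , refl

  -- The head n occurs e + 1 times, e < m - 1; every later value n + 1, …, hi at most m - 1 times.
  noSequenceWithin : (m n hi : ℕ) → Bool
  noSequenceWithin m n hi =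
    all (λ e → noPowerProducts m (m ∸ 1) (n ^ suc e) (applyUpTo (λ i → suc i + n) (hi ∸ n))) (upTo (m ∸ 1))

  noSequenceWithin-sound : ∀ {m n hi s} → T (noSequenceWithin m n hi) → Attains m n s → s ℤ.≤ + hi → ⊥
  noSequenceWithin-sound {m} {n} {hi} ok (.(+ n) ∷ as , seq , refl , final) s≤hi =
    noPowerProducts-sound (n ^ suc e) tail c (All.tabulate (λ {v} _ → multiplicity (+ v))) ok-e R Rᵐ≡product
    where
    open IsProductSeq seq
    c : ℕ → ℕ
    c v = count (+ v) (+ n ∷ as)
    e : ℕ
    e = count (+ n) as
    tail : List ℕ
    tail = applyUpTo (λ i → suc i + n) (hi ∸ n)
    R : ℕ
    R = proj₁ isPower
    ok-e : T (noPowerProducts m (m ∸ 1) (n ^ suc e) tail)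
    ok-e = All.lookup (All.all⁺ _ (upTo (m ∸ 1)) ok)
      (∈-upTo⁺ (subst (_≤ m ∸ 1) (count-∷-≡ (+ n) as) (multiplicity (+ n))))
    entries : All (λ x → ∃[ v ] v ∈ applyUpTo (_+ n) (suc (hi ∸ n)) × x ≡ + v) (+ n ∷ as)
    entries = All.zipWith (λ (n≤x , x≤s) → ∈-range n≤x (ℤₚ.≤-trans x≤s s≤hi))
      (Linked-≤-head sorted refl , Linked-≤-last sorted final)
    Rᵐ≡product : R ^ m ≡ n ^ suc e * powerProduct tail c
    Rᵐ≡product = ℤₚ.+-injective (begin
      + (R ^ m)                        ≡⟨ proj₂ isPower ⟨
      prodℤ (+ n ∷ as)                  ≡⟨ prodℤ-as-powerProduct (+ n ∷ as) (range-unique n (suc (hi ∸ n))) entries ⟩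
      + (n ^ c n * powerProduct tail c) ≡⟨ cong (λ t → + (n ^ t * powerProduct tail c)) (count-∷-≡ (+ n) as) ⟩
      + (n ^ suc e * powerProduct tail c) ∎)
      where open ≡-Reasoning

  exceptional-exceeds-double : ∀ {m n s} → Exceptional m n → Attains m n s → s ℤ.≤ + (2 * n) → ⊥
  exceptional-exceeds-double (inj₁ (refl , refl)) = noSequenceWithin-sound _
  exceptional-exceeds-double (inj₂ (inj₁ (refl , refl))) = noSequenceWithin-sound _
  exceptional-exceeds-double (inj₂ (inj₂ (refl , refl))) = noSequenceWithin-sound _

open import Data.Nat using (ℕ; _≥_; _*_; s≤s; z≤n)
open import Data.Integer using (ℤ; +_; _≤_; +≤+)
open import Data.Integer.Properties using (≤-trans)
open import Data.Product using (_×_; _,_)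
open import Data.Sum using (_⊎_)
open import Function.Bundles using (_⇔_; mk⇔)
open import Relation.Nullary using (¬_)
open import Relation.Binary.PropositionalEquality using (_≡_)

theorem4p10 : (m n : ℕ) → m ≥ 2 → (s : ℤ) → IsG m n s →
    ((s ≤ + (2 * n)) ⇔ (¬ ((m ≡ 2 × n ≡ 2) ⊎ (m ≡ 2 × n ≡ 3) ⊎ (m ≡ 3 × n ≡ 4))))
theorem4p10 m n (s≤s (s≤s z≤n)) s (attained , least) =
  mk⇔ (λ s≤2n exceptional → exceptional-exceeds-double exceptional attained s≤2n) within-double
  where
  within-double : ¬ Exceptional m n → s ≤ + (2 * n)
  within-double unexceptional with w , w≤2n , attains-w ← attains-at-most-double _ n unexceptional =
    ≤-trans (least (+ w) attains-w) (+≤+ w≤2n)
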